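{- For every positive integer $s$, $K_{3}^{RT}(3,s,3s-2)\le 5$.
   Context: For positive integers $m,s$, the RT poset $[m\times s]$ is $\{1,\dots,ms\}$ partitioned into blocks $B_i=\{is+1,\dots,(i+1)s\}$, $i=0,\dots,m-1$, each a chain $is+1\prec\cdots\prec(i+1)s$, with elements of different blocks incomparable. For $A\subseteq\{1,\dots,ms\}$, $\langle A\rangle$ is the smallest down-closed set containing $A$. For an integer $q\ge 2$, the RT distance on $\mathbb{Z}_q^{ms}$ is $d_{RT}(x,y)=|\langle\{i:x_i\ne y_i\}\rangle|$. A code $C\subseteq\mathbb{Z}_q^{ms}$ is an $R$-covering if every $x\in\mathbb{Z}_q^{ms}$ has some $c\in C$ with $d_{RT}(x,c)\le R$; $K_q^{RT}(m,s,R)$ is the minimum size of an $R$-covering. -}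

module Defs where

open import Data.Nat using (ℕ; zero; suc; _+_; _≤_; _≤?_)
open import Data.Fin using (Fin; toℕ)
open import Data.Fin.Properties using (any?) renaming (_≟_ to _≟ᶠ_)
open import Data.Product using (_×_; _,_; ∃; ∃-syntax)
open import Data.Product.Properties using () 
open import Data.List using (List; length)
open import Data.List.Membership.Propositional using (_∈_)
open import Relation.Nullary using (¬_; Dec; yes; no; _×-dec_; ¬?)
open import Relation.Nullary.Decidable using (⌊_⌋)
open import Relation.Binary.PropositionalEquality using (_≡_)
open import Data.Bool using (Bool; true; false)

-- The RT poset [m × s]: element (i , j) with i : Fin m, j : Fin s stands for
-- the integer i*s + j + 1 of {1,…,ms}; block B_i = { (i , j) | j : Fin s }.
Pos : ℕ → ℕ → Set
Pos m s = Fin m × Fin s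

_≼_ : ∀ {m s} → Pos m s → Pos m s → Set
(i , j) ≼ (i' , j') = (i ≡ i') × (toℕ j ≤ toℕ j')

_≼?_ : ∀ {m s} → (p q : Pos m s) → Dec (p ≼ q)
(i , j) ≼? (i' , j') = (i ≟ᶠ i') ×-dec (toℕ j ≤? toℕ j')

Word : ℕ → ℕ → ℕ → Set
Word q m s = Pos m s → Fin q

Differ : ∀ {q m s} → Word q m s → Word q m s → Pos m s → Set
Differ x y p = ¬ (x p ≡ y p)

InIdeal : ∀ {q m s} → Word q m s → Word q m s → Pos m s → Set
InIdeal x y p = ∃[ a ] (Differ x y a × (p ≼ a))

InIdeal? : ∀ {q m s} → (x y : Word q m s) → (p : Pos m s) → Dec (InIdeal x y p)
InIdeal? {q} {m} {s} x y p with any? (λ i → any? (λ j → ¬? (x (i , j) ≟ᶠ y (i , j)) ×-dec (p ≼? (i , j))))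
... | yes (i , j , d , le) = yes ((i , j) , d , le)
... | no ¬e = no (λ { ((i , j) , d , le) → ¬e (i , j , d , le) })

countFin : ∀ {n} → (Fin n → Bool) → ℕ
countFin {zero} f = 0
countFin {suc n} f with f Fin.zero
... | true = suc (countFin (λ i → f (Fin.suc i)))
... | false = countFin (λ i → f (Fin.suc i))

cardPos : ∀ {m s} → (Pos m s → Bool) → ℕ
cardPos {m} {s} A = sumFin (λ i → countFin (λ j → A (i , j)))
  where
  sumFin : ∀ {k} → (Fin k → ℕ) → ℕ
  sumFin {zero} g = 0
  sumFin {suc k} g = g Fin.zero + sumFin (λ i → g (Fin.suc i))

dRT : ∀ {q m s} → Word q m s → Word q m s → ℕ
dRT x y = cardPos (λ p → ⌊ InIdeal? x y p ⌋)

IsCovering : ∀ {q m s} → List (Word q m s) → ℕ → Set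
IsCovering C R = ∀ x → ∃[ c ] (c ∈ C × dRT x c ≤ R)

K-RT≤ : ℕ → ℕ → ℕ → ℕ → ℕ → Set
K-RT≤ q m s R N = ∃[ C ] (length {A = Word q m s} C ≤ N × IsCovering C R)

{-# OPTIONS --safe #-}
-- Use codewords that are constant on each block. If a word x and a codeword
-- agree on the top element of a block, the ideal generated by their difference
-- misses that top element and hence meets the block in at most s − 1 elements.
-- So it suffices that the three top coordinates of every x agree with some
-- codeword in at least two places, i.e. that {000, 011, 101, 110, 222} is a
-- Hamming covering of Z₃³ of radius 1; then the distance is at most 3s − 2.
module Submission where

open import Defs
open import Data.Bool using (Bool; true; false)
open import Data.Fin using (Fin; fromℕ; #_) renaming (zero to fzero; suc to fsuc)
open import Data.Fin.Properties using (toℕ-injective; ≤fromℕ; all?; _≟_)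
open import Data.List using (List; map)
open import Data.List.Membership.Propositional using (find)
open import Data.List.Membership.Propositional.Properties using (∈-map⁺)
open import Data.List.Relation.Unary.Any using (Any; any?)
open import Data.Nat using (ℕ; zero; suc; _+_; _*_; _∸_; _≤_; _<_; _≤?_; z≤n; s≤s)
open import Data.Nat.Properties
  using ( +-commutativeSemigroup; +-comm; +-identityʳ; +-mono-≤; +-monoʳ-≤
        ; ≤-refl; ≤-trans; ≤-antisym; ≤-reflexive; m≤n⇒m≤1+n; m+n≤o⇒m≤o∸n)
open import Data.Product using (_,_)
open import Data.Vec.Functional using (Vector; []; _∷_; foldr; toList)
open import Algebra.Properties.CommutativeSemigroup +-commutativeSemigroup using (interchange)
open import Relation.Binary.PropositionalEquality using (_≡_; refl; trans)
open import Relation.Nullary using (¬_; yes; no)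
open import Relation.Nullary.Decidable using (⌊_⌋; isYes≗does; dec-false; from-yes)

countFin-≤ : ∀ {n} (f : Fin n → Bool) → countFin f ≤ n
countFin-≤ {zero} f = z≤n
countFin-≤ {suc n} f with f fzero
... | true = s≤s (countFin-≤ (λ i → f (fsuc i)))
... | false = m≤n⇒m≤1+n (countFin-≤ (λ i → f (fsuc i)))

countFin-< : ∀ {n} (f : Fin n → Bool) (j : Fin n) → f j ≡ false → countFin f < n
countFin-< {suc n} f fzero fj≡false with f fzero
... | false = s≤s (countFin-≤ (λ i → f (fsuc i)))
countFin-< {suc n} f (fsuc j) fj≡false with f fzero
... | true = s≤s (countFin-< (λ i → f (fsuc i)) j fj≡false)
... | false = m≤n⇒m≤1+n (countFin-< (λ i → f (fsuc i)) j fj≡false)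

blockDistance : ∀ {q m s} → Word q m s → Word q m s → Fin m → ℕ
blockDistance x y i = countFin (λ j → ⌊ InIdeal? x y (i , j) ⌋)

tops : ∀ {q m t} → Word q m (suc t) → Vector (Fin q) m
tops {t = t} x i = x (i , fromℕ t)

blockConstant : ∀ {q m s} → Vector (Fin q) m → Word q m s
blockConstant v (i , _) = v i

top-∉-ideal : ∀ {q m t} (x y : Word q m (suc t)) i →
              tops x i ≡ tops y i → ¬ InIdeal x y (i , fromℕ t)
top-∉-ideal x y i agree ((.i , j) , differ , refl , top≤j)
  with toℕ-injective (≤-antisym (≤fromℕ j) top≤j)
... | refl = differ agree

agreement : ∀ {q} → Fin q → Fin q → ℕ
agreement a b with a ≟ b
... | yes _ = 1
... | no _ = 0

blockDistance-≤ : ∀ {q m s} (x y : Word q m s) i → blockDistance x y i ≤ s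
blockDistance-≤ x y i = countFin-≤ (λ j → ⌊ InIdeal? x y (i , j) ⌋)

blockDistance-< : ∀ {q m t} (x y : Word q m (suc t)) i →
                  tops x i ≡ tops y i → blockDistance x y i < suc t
blockDistance-< {t = t} x y i agree = countFin-< (λ j → ⌊ InIdeal? x y (i , j) ⌋) (fromℕ t)
  (trans (isYes≗does (InIdeal? x y (i , fromℕ t)))
         (dec-false (InIdeal? x y (i , fromℕ t)) (top-∉-ideal x y i agree)))

blockDistance+agreement≤ : ∀ {q m t} (x y : Word q m (suc t)) i →
                           blockDistance x y i + agreement (tops x i) (tops y i) ≤ suc t
blockDistance+agreement≤ x y i with tops x i ≟ tops y i
... | yes a≡b = ≤-trans (≤-reflexive (+-comm (blockDistance x y i) 1)) (blockDistance-< x y i a≡b)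
... | no _ = ≤-trans (≤-reflexive (+-identityʳ (blockDistance x y i))) (blockDistance-≤ x y i)

sum : ∀ {n} → Vector ℕ n → ℕ
sum = foldr _+_ 0

sum+sum≤ : ∀ {n k} (f g : Vector ℕ n) → (∀ i → f i + g i ≤ k) → sum f + sum g ≤ n * k
sum+sum≤ {zero} f g f+g≤k = z≤n
sum+sum≤ {suc n} f g f+g≤k = ≤-trans
  (≤-reflexive (interchange (f fzero) (sum (λ i → f (fsuc i))) (g fzero) (sum (λ i → g (fsuc i)))))
  (+-mono-≤ (f+g≤k fzero) (sum+sum≤ (λ i → f (fsuc i)) (λ i → g (fsuc i)) (λ i → f+g≤k (fsuc i))))

agreements : ∀ {q n} → Vector (Fin q) n → Vector (Fin q) n → ℕ
agreements v w = sum (λ i → agreement (v i) (w i))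

-- dRT sums over blocks with a helper local to cardPos; it agrees definitionally
-- with sum only for a concrete number of blocks, hence m = 3 here.
dRT+agreements≤ : ∀ {q t} (x y : Word q 3 (suc t)) →
                  dRT x y + agreements (tops x) (tops y) ≤ 3 * suc t
dRT+agreements≤ x y = sum+sum≤ (blockDistance x y) _ (blockDistance+agreement≤ x y)

dRT≤ : ∀ {q t} (x y : Word q 3 (suc t)) →
       2 ≤ agreements (tops x) (tops y) → dRT x y ≤ 3 * suc t ∸ 2
dRT≤ x y two≤agreements =
  m+n≤o⇒m≤o∸n (dRT x y) (≤-trans (+-monoʳ-≤ (dRT x y) two≤agreements) (dRT+agreements≤ x y))

radius1Code : List (Vector (Fin 3) 3)
radius1Code = toList ( (# 0 ∷ # 0 ∷ # 0 ∷ [])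
                     ∷ (# 0 ∷ # 1 ∷ # 1 ∷ [])
                     ∷ (# 1 ∷ # 0 ∷ # 1 ∷ [])
                     ∷ (# 1 ∷ # 1 ∷ # 0 ∷ [])
                     ∷ (# 2 ∷ # 2 ∷ # 2 ∷ [])
                     ∷ [])

radius1Code-covers : ∀ a b c → Any (λ w → 2 ≤ agreements (a ∷ b ∷ c ∷ []) w) radius1Code
radius1Code-covers = from-yes (all? λ a → all? λ b → all? λ c →
  any? (λ w → 2 ≤? agreements (a ∷ b ∷ c ∷ []) w) radius1Code)

corollary4 : (s : ℕ) → 1 ≤ s → K-RT≤ 3 3 s (3 * s ∸ 2) 5
corollary4 (suc t) _ = map blockConstant radius1Code , ≤-refl , covering
  where
  covering : IsCovering (map blockConstant radius1Code) (3 * suc t ∸ 2)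
  covering x with find (radius1Code-covers (tops x (# 0)) (tops x (# 1)) (tops x (# 2)))
  ... | w , w∈code , two≤agreements =
    blockConstant w , ∈-map⁺ blockConstant w∈code , dRT≤ x (blockConstant w) two≤agreements
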